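{- Let $k$ be a positive integer. Then every balanced rooted binary phylogenetic tree $\mathcal T$ of height $2^k-1$ perfectly embeds $2^{2^k-k-1}$ caterpillars each of size $2^k$; that is, the leaf set of $\mathcal T$ can be partitioned into $2^{2^k-k-1}$ sets $Y_1,\ldots,Y_m$, each of size $2^k$, such that each restriction $\mathcal T|Y_s$ is a $2^k$-caterpillar.
   Context: A rooted binary phylogenetic $X$-tree is a rooted tree with leaves labelled bijectively by the finite set $X$, with root of degree two and other interior vertices of degree three (or a single vertex if $|X|=1$). It is balanced if $|X|=2^m$ and its height (number of edges on a longest root-to-leaf path) is $m$. For $Y\subseteq X$, the restriction $\mathcal T|Y$ is obtained from the minimal subtree of $\mathcal T$ connecting the leaves in $Y$ by suppressing non-root degree-two vertices. An $n$-caterpillar is a rooted binary phylogenetic tree with $n$ leaves that is either a single leaf ($n=1$) or whose leaves can be ordered $l_1,\ldots,l_n$ such that $l_1,l_2$ have the same parent and, for each $i\in\{2,\ldots,n-1\}$, the parent of $l_{i+1}$ is the parent of the parent of $l_i$. -}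

module Defs where

open import Data.Nat using (ℕ; zero; suc; _⊔_; _^_)
open import Data.Bool using (true; false)
open import Data.List using (List; []; _∷_; [_]; _++_; length)
open import Data.List.Relation.Unary.Any using (any?)
open import Data.Maybe using (Maybe; just; nothing)
open import Data.Product using (_×_)
open import Relation.Nullary using (yes; no)
open import Relation.Binary.PropositionalEquality using (_≡_)
open import Relation.Binary.Definitions using (DecidableEquality)

-- Rooted binary trees with leaves labelled by elements of A.
-- (Children order is irrelevant for all notions below.)
data Tree (A : Set) : Set where
  leaf : A → Tree A
  node : Tree A → Tree A → Tree A

leaves : {A : Set} → Tree A → List A
leaves (leaf a)   = [ a ]
leaves (node l r) = leaves l ++ leaves r

height : {A : Set} → Tree A → ℕ
height (leaf _)   = 0
height (node l r) = suc (height l ⊔ height r)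

Balanced : {A : Set} → Tree A → ℕ → Set
Balanced T m = (length (leaves T) ≡ 2 ^ m) × (height T ≡ m)

-- Restriction T|Y: keep leaves in Y, drop empty subtrees, and suppress
-- the resulting degree-two vertices (a node with one surviving child is
-- replaced by that child).
restrict : {A : Set} → DecidableEquality A → List A → Tree A → Maybe (Tree A)
restrict _≟_ Y (leaf a) with any? (a ≟_) Y
... | yes _ = just (leaf a)
... | no  _ = nothing
restrict _≟_ Y (node l r) with restrict _≟_ Y l | restrict _≟_ Y r
... | just l' | just r' = just (node l' r')
... | just l' | nothing = just l'
... | nothing | just r' = just r'
... | nothing | nothing = nothing

data IsCaterpillar {A : Set} : Tree A → Set where
  cat-leaf  : (a : A) → IsCaterpillar (leaf a)
  cat-left  : (a : A) {t : Tree A} → IsCaterpillar t → IsCaterpillar (node (leaf a) t)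
  cat-right : (a : A) {t : Tree A} → IsCaterpillar t → IsCaterpillar (node t (leaf a))

-- A caterpillar on h + 1 leaves of a perfect tree of height h is obtained by
-- walking down a root-to-leaf path and picking one leaf from the sibling subtree
-- at every step.  Disjoint such caterpillars are built bottom-up: if each child
-- of a vertex of height h carries 2^j disjoint caterpillars on h leaves, every
-- caterpillar of one child is extended by an unused leaf of the other child,
-- giving 2^(j+1) caterpillars on h + 1 leaves.  This works as long as each child
-- still has 2^j unused leaves, i.e. 2^(j+1) (h+1) ≤ 2^h.  For h = 2^k - 1 and
-- j = 2^k - k - 1 this is an equality, so the caterpillars use up every leaf.
module Submission where

open import Defs
open import Data.Nat using (ℕ; zero; suc; _≤_; _<_; _^_; _∸_; _+_; _*_; z≤n; s≤s)
open import Data.Nat.Properties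
import Data.List as List
open import Data.List using (List; []; _∷_; [_]; _++_; length; concat; zipWith; drop)
open import Data.List.Properties using (length-++; concat-++; ++-assoc; ++-identityʳ; length-zipWith)
open import Data.List.Relation.Unary.All as All using (All; []; _∷_)
import Data.List.Relation.Unary.All.Properties as All
open import Data.List.Relation.Unary.Any using (here; there; any?)
open import Data.List.Membership.Propositional using (_∈_; _∉_)
open import Data.List.Membership.Propositional.Properties using (∈-++⁺ˡ; ∈-++⁺ʳ; ∈-++⁻)
open import Data.List.Relation.Binary.Subset.Propositional using (_⊆_)
open import Data.List.Relation.Binary.Disjoint.Propositional using (Disjoint)
open import Data.List.Relation.Unary.Unique.Propositional using (Unique)
open import Data.List.Relation.Unary.AllPairs.Core using ([]; _∷_)
open import Data.List.Relation.Binary.Permutation.Propositional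
  using (_↭_; ↭-refl; ↭-prep; ↭-sym; ↭-trans; ↭-reflexive; module PermutationReasoning)
open import Data.List.Relation.Binary.Permutation.Propositional.Properties
  using (∈-resp-↭; ↭-length; ++⁺; ++⁺ˡ; ++-comm; shift; ++-commutativeMonoid)
open import Algebra.Bundles using (CommutativeMonoid)
open import Data.Maybe using (Maybe; just; nothing)
open import Data.Product using (Σ; ∃; _×_; _,_)
open import Data.Sum using (inj₁; inj₂)
open import Data.Empty using (⊥-elim)
open import Relation.Nullary using (yes; no)
open import Relation.Binary.PropositionalEquality
  using (_≡_; refl; sym; trans; cong; cong₂; subst; module ≡-Reasoning)
open import Relation.Binary.Definitions using (DecidableEquality)
open import Function using (_∘_)

n<2^n : ∀ n → n < 2 ^ n
n<2^n zero    = s≤s z≤n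
n<2^n (suc n) = ≤-trans (≤-reflexive (+-comm 1 (suc n)))
  (+-mono-≤ (n<2^n n) (≤-trans (m^n>0 2 n) (m≤m+n _ 0)))

2^[2^k∸k∸1]*2^k≡2^[2^k∸1] : ∀ k → 2 ^ (2 ^ k ∸ k ∸ 1) * 2 ^ k ≡ 2 ^ (2 ^ k ∸ 1)
2^[2^k∸k∸1]*2^k≡2^[2^k∸1] k = begin
  2 ^ (2 ^ k ∸ k ∸ 1) * 2 ^ k  ≡⟨ ^-distribˡ-+-* 2 (2 ^ k ∸ k ∸ 1) k ⟨
  2 ^ (2 ^ k ∸ k ∸ 1 + k)      ≡⟨ cong (λ e → 2 ^ (e + k)) exponent-reorder ⟩
  2 ^ (2 ^ k ∸ 1 ∸ k + k)      ≡⟨ cong (2 ^_) (m∸n+n≡m (∸-monoˡ-≤ 1 (n<2^n k))) ⟩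
  2 ^ (2 ^ k ∸ 1)              ∎
  where
  open ≡-Reasoning
  exponent-reorder : 2 ^ k ∸ k ∸ 1 ≡ 2 ^ k ∸ 1 ∸ k
  exponent-reorder = trans (∸-+-assoc (2 ^ k) k 1)
    (trans (cong (2 ^ k ∸_) (+-comm k 1)) (sym (∸-+-assoc (2 ^ k) 1 k)))

m≤o⇒n≤o⇒m+n≡o+o⇒m≡o : ∀ {m n o} → m ≤ o → n ≤ o → m + n ≡ o + o → m ≡ o
m≤o⇒n≤o⇒m+n≡o+o⇒m≡o {m} {n} {o} m≤o n≤o e =
  ≤-antisym m≤o (+-cancelʳ-≤ o o m (≤-trans (≤-reflexive (sym e)) (+-monoʳ-≤ m n≤o)))

Unique-++⁻ : ∀ {X : Set} (xs : List X) {ys} → Unique (xs ++ ys) →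
             Unique xs × Unique ys × Disjoint xs ys
Unique-++⁻ []       u          = [] , u , λ ()
Unique-++⁻ (x ∷ xs) (x∉ ∷ u) with Unique-++⁻ xs u
... | uxs , uys , xs#ys = All.++⁻ˡ xs x∉ ∷ uxs , uys , disjoint
  where
  disjoint : Disjoint (x ∷ xs) _
  disjoint (here refl , x∈ys) = All.lookup x∉ (∈-++⁺ʳ xs x∈ys) refl
  disjoint (there v∈xs , v∈ys) = xs#ys (v∈xs , v∈ys)

data Perfect {X : Set} : Tree X → ℕ → Set where
  leaf : ∀ {a} → Perfect (leaf a) 0
  node : ∀ {l r h} → Perfect l h → Perfect r h → Perfect (node l r) (suc h)

module _ {X : Set} where

  perfect-length : ∀ {t : Tree X} {h} → Perfect t h → length (leaves t) ≡ 2 ^ h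
  perfect-length leaf = refl
  perfect-length (node {l} {h = h} pl pr) = trans (length-++ (leaves l))
    (cong₂ _+_ (perfect-length pl) (trans (perfect-length pr) (sym (+-identityʳ (2 ^ h)))))

  length-leaves≤2^ : ∀ (t : Tree X) {h} → height t ≤ h → length (leaves t) ≤ 2 ^ h
  length-leaves≤2^ (leaf _)   {h}     _         = m^n>0 2 h
  length-leaves≤2^ (node l r) {suc h} (s≤s t≤h) = ≤-trans (≤-reflexive (length-++ (leaves l)))
    (+-mono-≤ (length-leaves≤2^ l (m⊔n≤o⇒m≤o _ _ t≤h))
              (≤-trans (length-leaves≤2^ r (m⊔n≤o⇒n≤o _ _ t≤h)) (m≤m+n _ 0)))

  height≤-2^leaves⇒perfect : ∀ (t : Tree X) h → height t ≤ h → length (leaves t) ≡ 2 ^ h →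
                             Perfect t h
  height≤-2^leaves⇒perfect (leaf _)   zero    _         _ = leaf
  height≤-2^leaves⇒perfect (leaf _)   (suc h) _         e =
    ⊥-elim (<-irrefl refl (≤-trans (*-monoʳ-≤ 2 (m^n>0 2 h)) (≤-reflexive (sym e))))
  height≤-2^leaves⇒perfect (node l r) (suc h) (s≤s t≤h) e = node
    (height≤-2^leaves⇒perfect l h l≤h (m≤o⇒n≤o⇒m+n≡o+o⇒m≡o #l≤ #r≤ #l+#r))
    (height≤-2^leaves⇒perfect r h r≤h (m≤o⇒n≤o⇒m+n≡o+o⇒m≡o #r≤ #l≤
      (trans (+-comm (length (leaves r)) _) #l+#r)))
    where
    l≤h : height l ≤ h
    l≤h = m⊔n≤o⇒m≤o _ _ t≤h
    r≤h : height r ≤ h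
    r≤h = m⊔n≤o⇒n≤o _ _ t≤h
    #l≤ : length (leaves l) ≤ 2 ^ h
    #l≤ = length-leaves≤2^ l l≤h
    #r≤ : length (leaves r) ≤ 2 ^ h
    #r≤ = length-leaves≤2^ r r≤h
    #l+#r : length (leaves l) + length (leaves r) ≡ 2 ^ h + 2 ^ h
    #l+#r = trans (sym (length-++ (leaves l))) (trans e (cong (2 ^ h +_) (+-identityʳ _)))

module CaterpillarPacking {X : Set} (_≟_ : DecidableEquality X) where

  graft : Maybe (Tree X) → Maybe (Tree X) → Maybe (Tree X)
  graft (just l) (just r) = just (node l r)
  graft (just l) nothing  = just l
  graft nothing  r        = r

  restrict-node : ∀ Y l r →
    restrict _≟_ Y (node l r) ≡ graft (restrict _≟_ Y l) (restrict _≟_ Y r)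
  restrict-node Y l r with restrict _≟_ Y l | restrict _≟_ Y r
  ... | just _  | just _  = refl
  ... | just _  | nothing = refl
  ... | nothing | just _  = refl
  ... | nothing | nothing = refl

  restrict-cong : ∀ {Y Y'} t →
    (∀ {a} → a ∈ leaves t → a ∈ Y → a ∈ Y') →
    (∀ {a} → a ∈ leaves t → a ∈ Y' → a ∈ Y) →
    restrict _≟_ Y t ≡ restrict _≟_ Y' t
  restrict-cong {Y} {Y'} (leaf a) to from with any? (a ≟_) Y | any? (a ≟_) Y'
  ... | yes _   | yes _    = refl
  ... | yes a∈Y | no a∉Y'  = ⊥-elim (a∉Y' (to (here refl) a∈Y))
  ... | no a∉Y  | yes a∈Y' = ⊥-elim (a∉Y (from (here refl) a∈Y'))
  ... | no _    | no _     = refl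
  restrict-cong {Y} {Y'} (node l r) to from = begin
    restrict _≟_ Y (node l r)                      ≡⟨ restrict-node Y l r ⟩
    graft (restrict _≟_ Y l) (restrict _≟_ Y r)    ≡⟨ cong₂ graft
      (restrict-cong l (to ∘ ∈-++⁺ˡ) (from ∘ ∈-++⁺ˡ))
      (restrict-cong r (to ∘ ∈-++⁺ʳ (leaves l)) (from ∘ ∈-++⁺ʳ (leaves l))) ⟩
    graft (restrict _≟_ Y' l) (restrict _≟_ Y' r)  ≡⟨ restrict-node Y' l r ⟨
    restrict _≟_ Y' (node l r)                     ∎
    where open ≡-Reasoning

  restrict-disjoint : ∀ {Y} t → Disjoint Y (leaves t) → restrict _≟_ Y t ≡ nothing
  restrict-disjoint {Y} (leaf a) Y#t with any? (a ≟_) Y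
  ... | yes a∈Y = ⊥-elim (Y#t (a∈Y , here refl))
  ... | no _    = refl
  restrict-disjoint {Y} (node l r) Y#t
    rewrite restrict-node Y l r
          | restrict-disjoint l (λ (a∈Y , a∈l) → Y#t (a∈Y , ∈-++⁺ˡ a∈l))
          | restrict-disjoint r (λ (a∈Y , a∈r) → Y#t (a∈Y , ∈-++⁺ʳ (leaves l) a∈r)) = refl

  restrict-singleton : ∀ {x} t → Unique (leaves t) → x ∈ leaves t →
                       restrict _≟_ [ x ] t ≡ just (leaf x)
  restrict-singleton {x} (leaf x) _ (here refl) with any? (x ≟_) [ x ]
  ... | yes _   = refl
  ... | no x∉x  = ⊥-elim (x∉x (here refl))
  restrict-singleton {x} (node l r) u x∈t
    with Unique-++⁻ (leaves l) u | ∈-++⁻ (leaves l) x∈t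
  ... | ul , _ , l#r | inj₁ x∈l
    rewrite restrict-node [ x ] l r | restrict-singleton l ul x∈l
          | restrict-disjoint {[ x ]} r (λ { (here refl , x∈r) → l#r (x∈l , x∈r) }) = refl
  ... | _ , ur , l#r | inj₂ x∈r
    rewrite restrict-node [ x ] l r | restrict-singleton r ur x∈r
          | restrict-disjoint {[ x ]} l (λ { (here refl , x∈l) → l#r (x∈l , x∈r) }) = refl

  restrict-∷-∉ : ∀ {x Y} t → x ∉ leaves t → restrict _≟_ (x ∷ Y) t ≡ restrict _≟_ Y t
  restrict-∷-∉ t x∉t = restrict-cong t
    (λ { a∈t (here refl) → ⊥-elim (x∉t a∈t) ; _ (there a∈Y) → a∈Y })
    (λ _ → there)

  restrict-∷-disjoint : ∀ {x Y} t → Unique (leaves t) → x ∈ leaves t → Disjoint Y (leaves t) →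
                        restrict _≟_ (x ∷ Y) t ≡ just (leaf x)
  restrict-∷-disjoint t u x∈t Y#t = trans
    (restrict-cong t (λ { _ (here refl) → here refl
                        ; a∈t (there a∈Y) → ⊥-elim (Y#t (a∈Y , a∈t)) })
                     (λ { _ (here refl) → here refl ; _ (there ()) }))
    (restrict-singleton t u x∈t)

  record CaterpillarIn (t : Tree X) (n : ℕ) (Y : List X) : Set where
    field
      size        : length Y ≡ n
      ⊆-leaves    : Y ⊆ leaves t
      shape       : Tree X
      restrict≡   : restrict _≟_ Y t ≡ just shape
      caterpillar : IsCaterpillar shape

  open CaterpillarIn

  caterpillar-leaf : ∀ a → CaterpillarIn (leaf a) 1 [ a ]
  caterpillar-leaf a = record
    { size        = refl
    ; ⊆-leaves    = λ a∈ → a∈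
    ; shape       = leaf a
    ; restrict≡   = restrict-singleton (leaf a) ([] ∷ []) (here refl)
    ; caterpillar = cat-leaf a
    }

  graft-leafʳ : ∀ {l r n Y x} → Unique (leaves (node l r)) →
                x ∈ leaves r → CaterpillarIn l n Y → CaterpillarIn (node l r) (suc n) (x ∷ Y)
  graft-leafʳ {l} {r} {Y = Y} {x} u x∈r c with Unique-++⁻ (leaves l) u
  ... | _ , ur , l#r = record
    { size        = cong suc (size c)
    ; ⊆-leaves    = λ { (here refl) → ∈-++⁺ʳ (leaves l) x∈r
                      ; (there a∈Y) → ∈-++⁺ˡ (⊆-leaves c a∈Y) }
    ; shape       = node (shape c) (leaf x)
    ; restrict≡   = begin
        restrict _≟_ (x ∷ Y) (node l r)
          ≡⟨ restrict-node (x ∷ Y) l r ⟩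
        graft (restrict _≟_ (x ∷ Y) l) (restrict _≟_ (x ∷ Y) r)
          ≡⟨ cong₂ graft
               (restrict-∷-∉ l (λ x∈l → l#r (x∈l , x∈r)))
               (restrict-∷-disjoint r ur x∈r (λ (a∈Y , a∈r) → l#r (⊆-leaves c a∈Y , a∈r))) ⟩
        graft (restrict _≟_ Y l) (just (leaf x))
          ≡⟨ cong (λ m → graft m (just (leaf x))) (restrict≡ c) ⟩
        just (node (shape c) (leaf x))
          ∎
    ; caterpillar = cat-right x (caterpillar c)
    }
    where open ≡-Reasoning

  graft-leafˡ : ∀ {l r n Y x} → Unique (leaves (node l r)) →
                x ∈ leaves l → CaterpillarIn r n Y → CaterpillarIn (node l r) (suc n) (x ∷ Y)
  graft-leafˡ {l} {r} {Y = Y} {x} u x∈l c with Unique-++⁻ (leaves l) u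
  ... | ul , _ , l#r = record
    { size        = cong suc (size c)
    ; ⊆-leaves    = λ { (here refl) → ∈-++⁺ˡ x∈l
                      ; (there a∈Y) → ∈-++⁺ʳ (leaves l) (⊆-leaves c a∈Y) }
    ; shape       = node (leaf x) (shape c)
    ; restrict≡   = begin
        restrict _≟_ (x ∷ Y) (node l r)
          ≡⟨ restrict-node (x ∷ Y) l r ⟩
        graft (restrict _≟_ (x ∷ Y) l) (restrict _≟_ (x ∷ Y) r)
          ≡⟨ cong₂ graft
               (restrict-∷-disjoint l ul x∈l (λ (a∈Y , a∈l) → l#r (a∈l , ⊆-leaves c a∈Y)))
               (restrict-∷-∉ r (λ x∈r → l#r (x∈l , x∈r))) ⟩
        graft (just (leaf x)) (restrict _≟_ Y r)
          ≡⟨ cong (graft (just (leaf x))) (restrict≡ c) ⟩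
        just (node (leaf x) (shape c))
          ∎
    ; caterpillar = cat-left x (caterpillar c)
    }
    where open ≡-Reasoning

  length-concat-uniform : ∀ {n} (Ys : List (List X)) → All (λ Y → length Y ≡ n) Ys →
                          length (concat Ys) ≡ length Ys * n
  length-concat-uniform []       []        = refl
  length-concat-uniform (Y ∷ Ys) (Y≡ ∷ Ys≡) =
    trans (length-++ Y) (cong₂ _+_ Y≡ (length-concat-uniform Ys Ys≡))

  prependEach : List X → List (List X) → List (List X)
  prependEach = zipWith List._∷_

  length-prependEach : ∀ (xs : List X) Ys → length Ys ≤ length xs →
                       length (prependEach xs Ys) ≡ length Ys
  length-prependEach xs Ys le = trans (length-zipWith List._∷_ xs Ys) (m≥n⇒m⊓n≡n le)

  prependEach-↭ : ∀ (xs : List X) Ys → length Ys ≤ length xs →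
                  concat (prependEach xs Ys) ++ drop (length Ys) xs ↭ concat Ys ++ xs
  prependEach-↭ []       []       _        = ↭-refl
  prependEach-↭ (x ∷ xs) []       _        = ↭-refl
  prependEach-↭ (x ∷ xs) (Y ∷ Ys) (s≤s le) = begin
    x ∷ (Y ++ concat (prependEach xs Ys)) ++ drop (length Ys) xs
      ≡⟨ cong (x ∷_) (++-assoc Y _ _) ⟩
    x ∷ Y ++ concat (prependEach xs Ys) ++ drop (length Ys) xs
      ↭⟨ ↭-prep x (++⁺ˡ Y (prependEach-↭ xs Ys le)) ⟩
    x ∷ Y ++ concat Ys ++ xs
      ≡⟨ cong (x ∷_) (sym (++-assoc Y _ _)) ⟩
    x ∷ (Y ++ concat Ys) ++ xs
      ↭⟨ ↭-sym (shift x (Y ++ concat Ys) xs) ⟩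
    (Y ++ concat Ys) ++ x ∷ xs
      ∎
    where open PermutationReasoning

  All-prependEach : ∀ {R : X → Set} {P Q : List X → Set} {xs Ys} →
                    (∀ {x Y} → R x → P Y → Q (x ∷ Y)) → All R xs → All P Ys →
                    All Q (prependEach xs Ys)
  All-prependEach f []         _          = []
  All-prependEach f (_ ∷ _)    []         = []
  All-prependEach f (Rx ∷ Rxs) (PY ∷ PYs) = f Rx PY ∷ All-prependEach f Rxs PYs

  record Packing (t : Tree X) (n m : ℕ) : Set where
    field
      pieces       : List (List X)
      rest         : List X
      count        : length pieces ≡ m
      caterpillars : All (CaterpillarIn t n) pieces
      partition    : concat pieces ++ rest ↭ leaves t

  open Packing

  empty-packing : ∀ {t n} → Packing t n 0
  empty-packing {t} = record
    { pieces = [] ; rest = leaves t ; count = refl ; caterpillars = [] ; partition = ↭-refl }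

  leaf-packing : ∀ a → Packing (leaf a) 1 1
  leaf-packing a = record
    { pieces = [ [ a ] ] ; rest = [] ; count = refl
    ; caterpillars = caterpillar-leaf a ∷ [] ; partition = ↭-refl }

  rest-⊆ : ∀ {t n m} (P : Packing t n m) → rest P ⊆ leaves t
  rest-⊆ P a∈rest = ∈-resp-↭ (partition P) (∈-++⁺ʳ (concat (pieces P)) a∈rest)

  rest-length : ∀ {t n m} (P : Packing t n m) → m * n + length (rest P) ≡ length (leaves t)
  rest-length {t} {n} {m} P = begin
    m * n + length (rest P)                       ≡⟨ cong (λ k → k * n + length (rest P)) (count P) ⟨
    length (pieces P) * n + length (rest P)       ≡⟨ cong (_+ length (rest P))
      (length-concat-uniform (pieces P) (All.map size (caterpillars P))) ⟨
    length (concat (pieces P)) + length (rest P)  ≡⟨ sym (length-++ (concat (pieces P))) ⟩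
    length (concat (pieces P) ++ rest P)          ≡⟨ ↭-length (partition P) ⟩
    length (leaves t)                             ∎
    where open ≡-Reasoning

  rest-room : ∀ {t n m} (P : Packing t n m) {k} → k + m * n ≤ length (leaves t) →
              k ≤ length (rest P)
  rest-room {t} {n} {m} P {k} le = +-cancelˡ-≤ (m * n) k (length (rest P))
    (≤-trans (≤-reflexive (+-comm (m * n) k)) (≤-trans le (≤-reflexive (sym (rest-length P)))))

  exact-packing : ∀ {t n m} (P : Packing t n m) → m * n ≡ length (leaves t) →
                  concat (pieces P) ↭ leaves t
  exact-packing {t} {n} {m} P e with rest P | partition P | rest-length P
  ... | []    | p | _  = ↭-trans (↭-reflexive (sym (++-identityʳ _))) p
  ... | _ ∷ _ | _ | e′ = ⊥-elim (1+n≢0 (+-cancelˡ-≡ (m * n) _ 0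
                           (trans e′ (trans (sym e) (sym (+-identityʳ (m * n)))))))

  packing-node : ∀ {l r n m₁ m₂} → Unique (leaves (node l r)) →
                 (P : Packing l n m₁) (Q : Packing r n m₂) →
                 m₁ ≤ length (rest Q) → m₂ ≤ length (rest P) →
                 Packing (node l r) (suc n) (m₁ + m₂)
  packing-node {l} {r} u P Q m₁≤ m₂≤ = record
    { pieces       = A ++ B
    ; rest         = a ++ b
    ; count        = trans (length-++ A)
                       (cong₂ _+_ (trans (length-prependEach (rest Q) (pieces P) P≤) (count P))
                                  (trans (length-prependEach (rest P) (pieces Q) Q≤) (count Q)))
    ; caterpillars = All.++⁺
        (All-prependEach (graft-leafʳ u) (All.tabulate (rest-⊆ Q)) (caterpillars P))
        (All-prependEach (graft-leafˡ u) (All.tabulate (rest-⊆ P)) (caterpillars Q))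
    ; partition    = begin
        concat (A ++ B) ++ (a ++ b)
          ≡⟨ cong (_++ (a ++ b)) (concat-++ A B) ⟨
        (concat A ++ concat B) ++ (a ++ b)
          ↭⟨ interchange (concat A) (concat B) a b ⟩
        (concat A ++ a) ++ (concat B ++ b)
          ↭⟨ ++⁺ (prependEach-↭ (rest Q) (pieces P) P≤) (prependEach-↭ (rest P) (pieces Q) Q≤) ⟩
        (concat (pieces P) ++ rest Q) ++ (concat (pieces Q) ++ rest P)
          ↭⟨ ++⁺ˡ (concat (pieces P) ++ rest Q) (++-comm (concat (pieces Q)) (rest P)) ⟩
        (concat (pieces P) ++ rest Q) ++ (rest P ++ concat (pieces Q))
          ↭⟨ interchange (concat (pieces P)) (rest Q) (rest P) (concat (pieces Q)) ⟩
        (concat (pieces P) ++ rest P) ++ (rest Q ++ concat (pieces Q))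
          ↭⟨ ++⁺ (partition P) (↭-trans (++-comm (rest Q) (concat (pieces Q))) (partition Q)) ⟩
        leaves l ++ leaves r
          ∎
    }
    where
    open PermutationReasoning
    open CommutativeMonoid (++-commutativeMonoid {A = X}) using (commutativeSemigroup)
    open import Algebra.Properties.CommutativeSemigroup commutativeSemigroup using (interchange)
    P≤ : length (pieces P) ≤ length (rest Q)
    P≤ = subst (_≤ length (rest Q)) (sym (count P)) m₁≤
    Q≤ : length (pieces Q) ≤ length (rest P)
    Q≤ = subst (_≤ length (rest P)) (sym (count Q)) m₂≤
    A B : List (List X)
    A = prependEach (rest Q) (pieces P)
    B = prependEach (rest P) (pieces Q)
    a b : List X
    a = drop (length (pieces P)) (rest Q)
    b = drop (length (pieces Q)) (rest P)

  perfect-packing : ∀ {t h} j → Unique (leaves t) → Perfect t h → 2 ^ j * suc h ≤ 2 ^ h →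
                    Packing t (suc h) (2 ^ j)
  perfect-packing zero    _ leaf _ = leaf-packing _
  perfect-packing (suc j) _ leaf c = ⊥-elim (<-irrefl refl (begin-strict
    1                  <⟨ *-monoʳ-≤ 2 (m^n>0 2 j) ⟩
    2 ^ suc j          ≡⟨ *-identityʳ (2 ^ suc j) ⟨
    2 ^ suc j * 1      ≤⟨ c ⟩
    1                  ∎))
    where open ≤-Reasoning
  perfect-packing {node l r} {suc h} zero u (node pl pr) _ with Unique-++⁻ (leaves l) u
  ... | ul , _ , _ = packing-node u Pl empty-packing 1≤#r z≤n
    where
    Pl : Packing l (suc h) 1
    Pl = perfect-packing zero ul pl (≤-trans (≤-reflexive (*-identityˡ (suc h))) (n<2^n h))
    1≤#r : 1 ≤ length (leaves r)
    1≤#r = ≤-trans (m^n>0 2 h) (≤-reflexive (sym (perfect-length pr)))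
  perfect-packing {node l r} {suc h} (suc j) u (node pl pr) c with Unique-++⁻ (leaves l) u
  ... | ul , ur , _ = subst (Packing (node l r) (suc (suc h))) (cong (2 ^ j +_) (sym (+-identityʳ _)))
                        (packing-node u Pl Pr (rest-room Pr (room pr)) (rest-room Pl (room pl)))
    where
    halved : 2 ^ j + 2 ^ j * suc h ≤ 2 ^ h
    halved = ≤-trans (≤-reflexive (sym (*-suc (2 ^ j) (suc h))))
               (*-cancelˡ-≤ 2 (≤-trans (≤-reflexive (sym (*-assoc 2 (2 ^ j) (suc (suc h))))) c))
    room : ∀ {t} → Perfect t h → 2 ^ j + 2 ^ j * suc h ≤ length (leaves t)
    room pt = ≤-trans halved (≤-reflexive (sym (perfect-length pt)))
    Pl : Packing l (suc h) (2 ^ j)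
    Pl = perfect-packing j ul pl (≤-trans (m≤n+m _ (2 ^ j)) halved)
    Pr : Packing r (suc h) (2 ^ j)
    Pr = perfect-packing j ur pr (≤-trans (m≤n+m _ (2 ^ j)) halved)

corollary7 : (k : ℕ) → 1 ≤ k →
  {X : Set} (_≟_ : DecidableEquality X) (T : Tree X) →
  Unique (leaves T) → Balanced T (2 ^ k ∸ 1) →
  Σ (List (List X)) λ Ys →
    (length Ys ≡ 2 ^ (2 ^ k ∸ k ∸ 1)) ×
    (concat Ys ↭ leaves T) ×
    All (λ Y → (length Y ≡ 2 ^ k) ×
               ∃ λ C → (restrict _≟_ Y T ≡ just C) × IsCaterpillar C) Ys
corollary7 k _ _≟_ T u (#T≡ , height≡) =
  pieces P , count P , exact-packing P (trans tight (sym #T≡)) , All.map of-size-2^k (caterpillars P)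
  where
  open CaterpillarPacking _≟_
  open Packing
  open CaterpillarIn
  h j : ℕ
  h = 2 ^ k ∸ 1
  j = 2 ^ k ∸ k ∸ 1
  suc-h≡2^k : suc h ≡ 2 ^ k
  suc-h≡2^k = m+[n∸m]≡n (m^n>0 2 k)
  tight : 2 ^ j * suc h ≡ 2 ^ h
  tight = trans (cong (2 ^ j *_) suc-h≡2^k) (2^[2^k∸k∸1]*2^k≡2^[2^k∸1] k)
  P : Packing T (suc h) (2 ^ j)
  P = perfect-packing j u (height≤-2^leaves⇒perfect T h (≤-reflexive height≡) #T≡) (≤-reflexive tight)
  of-size-2^k : ∀ {Y} → CaterpillarIn T (suc h) Y →
                (length Y ≡ 2 ^ k) × ∃ λ C → (restrict _≟_ Y T ≡ just C) × IsCaterpillar C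
  of-size-2^k c = trans (size c) suc-h≡2^k , shape c , restrict≡ c , caterpillar c
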